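{- Let $K=(V,\mathcal{C})$ be a neighbourly abstract cubical complex with $V$ a finite set, and let $G=(V,E)$ be the graph of $K$. Then the edge expansion of $G$ satisfies $\chi(G)\geq 1$.
   Context: An (abstract) cubical complex is a pair $K=(V,\mathcal{C})$ of a set $V$ and a set $\mathcal{C}$ of subsets of $V$ ("cubes") such that (1) $c_1,c_2\in\mathcal{C}\Rightarrow c_1\cap c_2\in\mathcal{C}$, and (2) for every $c\in\mathcal{C}$ there is $d\geq 0$ and a bijection $\phi_c:\{0,1\}^d\to c$ such that for a subset $s\subseteq\{0,1\}^d$, the image $\phi_c(s)$ is a member of $\mathcal{C}$ if and only if $s$ is (the vertex set of) a face of the cube $[0,1]^d$. The graph of $K$ is the graph $G=(V,E)$ with $\{v_1,v_2\}\in E$ if and only if $\{v_1,v_2\}\in\mathcal{C}$ (with $v_1\neq v_2$). The complex is neighbourly if for every pair of vertices $v,w\in V$ there is a cube $c\in\mathcal{C}$ with $v,w\in c$. The edge expansion of a graph $G=(V,E)$ is $\chi(G)=\min_{X\subset V,\ 0<|X|\leq \frac12|V|}\frac{|\delta(X)|}{|X|}$, where $\delta(X)$ is the set of edges with exactly one endpoint in $X$. -}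

module Defs where

open import Data.Nat using (ℕ; _+_; _*_; _≤_; _<_)
open import Data.Bool using (Bool; true; false; _∧_; not; if_then_else_)
open import Data.Fin using (Fin; _≟_)
open import Data.Fin.Subset using (Subset; _∈_; _∉_; _∩_; _∪_; ⁅_⁆; ∣_∣; Nonempty)
open import Data.Fin.Subset.Properties using (_∈?_)
open import Data.Vec using (Vec; lookup)
open import Data.List using (List; allFin; map)
open import Data.Nat.ListAction using (sum)
open import Data.Product using (Σ; ∃; _×_; _,_)
open import Function.Bundles using (_⇔_)
open import Function.Definitions using (Injective)
open import Relation.Binary.PropositionalEquality using (_≡_)
open import Relation.Nullary using (does)

CubeVert : ℕ → Set
CubeVert d = Vec Bool d

-- A subset s of {0,1}^d (given by its characteristic function) is the
-- vertex set of a (nonempty) face of [0,1]^d : there are a set I of fixed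
-- coordinates and a vertex a such that s = { x | x_i = a_i for all i ∈ I }.
IsFace : (d : ℕ) → (CubeVert d → Bool) → Set
IsFace d s = Σ (Fin d → Bool) λ I → Σ (CubeVert d) λ a →
  ∀ (x : CubeVert d) →
    (s x ≡ true) ⇔ (∀ (i : Fin d) → I i ≡ true → lookup x i ≡ lookup a i)

Family : ℕ → Set
Family n = Subset n → Bool

_∈𝒞_ : ∀ {n} → Subset n → Family n → Set
c ∈𝒞 𝒞 = 𝒞 c ≡ true

IsImage : ∀ {n d} → (CubeVert d → Fin n) → (CubeVert d → Bool) → Subset n → Set
IsImage {n} {d} φ s S = ∀ (v : Fin n) → (v ∈ S) ⇔ (Σ (CubeVert d) λ x → s x ≡ true × φ x ≡ v)

IsBijectionOnto : ∀ {n d} → (CubeVert d → Fin n) → Subset n → Set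
IsBijectionOnto {n} {d} φ c =
  Injective _≡_ _≡_ φ × (∀ (v : Fin n) → (v ∈ c) ⇔ (Σ (CubeVert d) λ x → φ x ≡ v))

-- Abstract cubical complex on the finite vertex set V = Fin n.
-- (1) is imposed for nonempty intersections.
IsCubicalComplex : (n : ℕ) → Family n → Set
IsCubicalComplex n 𝒞 =
  (∀ (c₁ c₂ : Subset n) → c₁ ∈𝒞 𝒞 → c₂ ∈𝒞 𝒞 → Nonempty (c₁ ∩ c₂) → (c₁ ∩ c₂) ∈𝒞 𝒞)
  × (∀ (c : Subset n) → c ∈𝒞 𝒞 →
       Σ ℕ λ d → Σ (CubeVert d → Fin n) λ φ → IsBijectionOnto φ c ×
         (∀ (s : CubeVert d → Bool) (S : Subset n) → IsImage φ s S →
            (S ∈𝒞 𝒞) ⇔ IsFace d s))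

IsNeighbourly : (n : ℕ) → Family n → Set
IsNeighbourly n 𝒞 = ∀ (v w : Fin n) → Σ (Subset n) λ c → c ∈𝒞 𝒞 × v ∈ c × w ∈ c

isEdge : ∀ {n} → Family n → Fin n → Fin n → Bool
isEdge 𝒞 u v = not (does (u ≟ v)) ∧ 𝒞 (⁅ u ⁆ ∪ ⁅ v ⁆)

-- |δ(X)| : each edge with exactly one endpoint in X is counted once,
-- as the ordered pair (u , v) with u ∈ X and v ∉ X.
boundarySize : ∀ {n} → Family n → Subset n → ℕ
boundarySize {n} 𝒞 X =
  sum (map (λ u → sum (map (λ v →
    if does (u ∈? X) ∧ not (does (v ∈? X)) ∧ isEdge 𝒞 u v then 1 else 0)
    (allFin n))) (allFin n))

-- χ(G) ≥ k  (k ∈ ℕ) : |δ(X)|/|X| ≥ k for all X with 0 < |X| ≤ |V|/2.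
EdgeExpansionAtLeast : ∀ {n} → Family n → ℕ → Set
EdgeExpansionAtLeast {n} 𝒞 k =
  ∀ (X : Subset n) → 0 < ∣ X ∣ → 2 * ∣ X ∣ ≤ n → k * ∣ X ∣ ≤ boundarySize 𝒞 X

-- If x ∈ X and y ∉ X, neighbourliness places x and y at antipodal vertices a and ā of some cube
-- (while their coordinates agree somewhere, pass to the facet fixing that coordinate). Flipping the
-- coordinates of a one at a time walks along edges from x to y, so the walk crosses δ(X) along an edge
-- uw with u ∈ X, w ∉ X. Map (x, y), together with a bit choosing u or w, to (u, w, t), where t is the
-- antipode of the chosen endpoint in that cube. The map is injective: a cube containing two antipodal
-- vertices of another cube contains all of it (their intersection is a face through two antipodes),
-- so t and the chosen endpoint determine the cube, and in it u, w determine the step and hence a.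
-- Counting gives 2 |X| |V∖X| ≤ |δ(X)| |V|, and |X| ≤ |V∖X| turns this into |X| ≤ |δ(X)|.

module Submission where

open import Defs
open import Axiom.UniquenessOfIdentityProofs using (module Decidable⇒UIP)
open import Data.Bool using (Bool; true; false; not; _∧_; if_then_else_)
open import Data.Bool.Properties using (not-involutive; not-¬; ¬-not; T-≡) renaming (_≟_ to _≟ᵇ_)
open import Data.Fin using (Fin; zero; suc; fromℕ; inject₁; _≟_)
open import Data.Fin.Properties using (any?)
open import Data.Fin.Subset using (Subset; inside; outside; _∈_; _∉_; _⊆_; _⊂_; _∩_; _∪_; ⁅_⁆; ∁; ∣_∣)
open import Data.Fin.Subset.Properties
  using (_∈?_; x∈p∩q⁺; x∈p∩q⁻; x∈p∪q⁺; x∈p∪q⁻; x∈⁅x⁆; x∈⁅y⁆⇒x≡y; p⊂q⇒∣p∣<∣q∣; ⊆-antisym;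
         x∈∁p⇒x∉p; ∣∁p∣≡n∸∣p∣; ∣p∣≤n)
open import Data.List using (List; []; _∷_; _++_; map; length; filter; allFin; cartesianProduct)
import Data.List as List
open import Data.List.Properties
  using (length-++; length-map; length-++-sucʳ; length-tabulate; map-++; map-∘; map-tabulate)
open import Data.List.Membership.Propositional using () renaming (_∈_ to _∈ˡ_)
open import Data.List.Membership.Propositional.Properties
  using (∈-∃++; ∈-++⁻; ∈-++⁺ˡ; ∈-++⁺ʳ; ∈-cartesianProduct⁺; ∈-cartesianProduct⁻; ∈-filter⁺; ∈-filter⁻; ∈-allFin)
open import Data.List.Relation.Unary.Any using (here; there)
open import Data.List.Relation.Unary.All using ([]; _∷_)
import Data.List.Relation.Unary.All as All
open import Data.List.Relation.Unary.AllPairs using ([]; _∷_)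
open import Data.List.Relation.Unary.Unique.Propositional using (Unique)
open import Data.List.Relation.Unary.Unique.Propositional.Properties
  using (cartesianProduct⁺; filter⁺; allFin⁺)
open import Data.Nat using (ℕ; zero; suc; _+_; _*_; _≤_; _<_; z≤n; s≤s)
open import Data.Nat.Induction using (<-wellFounded)
open import Data.Nat.ListAction using (sum)
open import Data.Nat.ListAction.Properties using (sum-++)
open import Data.Nat.Properties
  using (+-cancelˡ-≤; *-distribˡ-+; *-monoʳ-≤; +-monoˡ-≤; +-identityʳ; *-identityˡ; *-cancelʳ-≤; m+[n∸m]≡n;
         module ≤-Reasoning)
open import Data.Product using (Σ; ∃; _×_; _,_; proj₁; proj₂)
open import Data.Sum using (_⊎_; inj₁; inj₂)
open import Data.Vec using (Vec; []; _∷_; lookup; tabulate; replicate; updateAt) renaming (map to mapᵛ)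
open import Data.Vec.Properties
  using (≡-dec; lookup-map; lookup∘tabulate; []=⇒lookup; lookup⇒[]=; lookup∘updateAt; lookup∘updateAt′;
         map-cong; map-id; tabulate∘lookup; tabulate-cong)
  renaming (map-∘ to mapᵛ-∘)
open import Function using (_∘_)
open import Function.Bundles using (_⇔_; mk⇔; Equivalence)
open import Function.Definitions using (Injective)
open import Induction.WellFounded using (Acc; acc)
open import Relation.Binary.Definitions using (DecidableEquality)
open import Relation.Binary.PropositionalEquality
open import Relation.Nullary using (Dec; does; yes; no; ¬_; contradiction; ¬?; _×-dec_; _⊎-dec_)
open import Relation.Nullary.Decidable using (T?; dec-true; dec-false)
open import Relation.Unary using (Pred; Decidable)

open Equivalence using (to; from)

does-true⇒ : ∀ {P : Set} (P? : Dec P) → does P? ≡ true → P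
does-true⇒ (yes p) _ = p

switches-off : ∀ {m} {P : Fin (suc m) → Set} → Decidable P → P zero → ¬ P (fromℕ m) →
  ∃ λ (i : Fin m) → P (inject₁ i) × ¬ P (suc i)
switches-off {zero} P? p₀ ¬pₘ = contradiction p₀ ¬pₘ
switches-off {suc m} {P} P? p₀ ¬pₘ with P? (suc zero)
... | no ¬p₁ = zero , p₀ , ¬p₁
... | yes p₁ = let i , pᵢ , ¬pᵢ₊₁ = switches-off {P = P ∘ suc} (P? ∘ suc) p₁ ¬pₘ in suc i , pᵢ , ¬pᵢ₊₁

∈-++-skip : ∀ {A : Set} {v y : A} ys₁ {ys₂} → v ∈ˡ ys₁ ++ y ∷ ys₂ → v ≢ y → v ∈ˡ ys₁ ++ ys₂
∈-++-skip ys₁ v∈ v≢y with ∈-++⁻ ys₁ v∈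
... | inj₁ v∈ys₁ = ∈-++⁺ˡ v∈ys₁
... | inj₂ (here v≡y) = contradiction v≡y v≢y
... | inj₂ (there v∈ys₂) = ∈-++⁺ʳ ys₁ v∈ys₂

module _ {A : Set} where

  length-≤-injection : ∀ {B : Set} (f : A → B) {xs : List A} {ys : List B} → Unique xs →
    (∀ {x x′} → x ∈ˡ xs → x′ ∈ˡ xs → f x ≡ f x′ → x ≡ x′) →
    (∀ {x} → x ∈ˡ xs → f x ∈ˡ ys) →
    length xs ≤ length ys
  length-≤-injection f {[]} _ _ _ = z≤n
  length-≤-injection f {x ∷ xs} (x∉xs ∷ unique) inj into with ∈-∃++ (into (here refl))
  ... | ys₁ , ys₂ , refl =
    subst (suc (length xs) ≤_) (sym (length-++-sucʳ ys₁ (f x) ys₂))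
      (s≤s (length-≤-injection f unique (λ m m′ → inj (there m) (there m′)) into′))
    where
    into′ : ∀ {x′} → x′ ∈ˡ xs → f x′ ∈ˡ ys₁ ++ ys₂
    into′ m = ∈-++-skip ys₁ (into (there m))
      (λ fx′≡fx → All.lookup x∉xs m (inj (here refl) (there m) (sym fx′≡fx)))

  length-cartesianProduct : ∀ {B : Set} (xs : List A) (ys : List B) →
    length (cartesianProduct xs ys) ≡ length xs * length ys
  length-cartesianProduct [] ys = refl
  length-cartesianProduct (x ∷ xs) ys = begin
    length (map (x ,_) ys ++ cartesianProduct xs ys)
      ≡⟨ length-++ (map (x ,_) ys) ⟩
    length (map (x ,_) ys) + length (cartesianProduct xs ys)
      ≡⟨ cong₂ _+_ (length-map (x ,_) ys) (length-cartesianProduct xs ys) ⟩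
    length ys + length xs * length ys ∎
    where open ≡-Reasoning

  length-filter≡sum : ∀ {p} {P : Pred A p} (P? : Decidable P) xs →
    length (filter P? xs) ≡ sum (map (λ x → if does (P? x) then 1 else 0) xs)
  length-filter≡sum P? [] = refl
  length-filter≡sum P? (x ∷ xs) with does (P? x)
  ... | true = cong suc (length-filter≡sum P? xs)
  ... | false = length-filter≡sum P? xs

  sum-cartesianProduct : ∀ {B : Set} (f : A × B → ℕ) xs ys →
    sum (map f (cartesianProduct xs ys)) ≡ sum (map (λ x → sum (map (λ y → f (x , y)) ys)) xs)
  sum-cartesianProduct f [] ys = refl
  sum-cartesianProduct f (x ∷ xs) ys = begin
    sum (map f (map (x ,_) ys ++ cartesianProduct xs ys))
      ≡⟨ cong sum (map-++ f (map (x ,_) ys) _) ⟩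
    sum (map f (map (x ,_) ys) ++ map f (cartesianProduct xs ys))
      ≡⟨ sum-++ (map f (map (x ,_) ys)) _ ⟩
    sum (map f (map (x ,_) ys)) + sum (map f (cartesianProduct xs ys))
      ≡⟨ cong₂ _+_ (cong sum (sym (map-∘ ys))) (sum-cartesianProduct f xs ys) ⟩
    sum (map (λ y → f (x , y)) ys) + sum (map (λ x → sum (map (λ y → f (x , y)) ys)) xs) ∎
    where open ≡-Reasoning

map-allFin-suc : ∀ {A : Set} {n} (g : Fin (suc n) → A) → map (g ∘ suc) (allFin n) ≡ map g (List.tabulate suc)
map-allFin-suc g = trans (map-tabulate (λ i → i) (g ∘ suc)) (sym (map-tabulate suc g))

indicator : ∀ {n} → Subset n → Fin n → ℕ
indicator p i = if does (i ∈? p) then 1 else 0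

∣p∣≡sum : ∀ {n} (p : Subset n) → ∣ p ∣ ≡ sum (map (indicator p) (allFin n))
∣p∣≡sum [] = refl
∣p∣≡sum (inside ∷ p) = cong suc (trans (∣p∣≡sum p) (cong sum (map-allFin-suc (indicator (inside ∷ p)))))
∣p∣≡sum (outside ∷ p) = trans (∣p∣≡sum p) (cong sum (map-allFin-suc (indicator (outside ∷ p))))

length-filter-∈ : ∀ {n} (p : Subset n) → length (filter (_∈? p) (allFin n)) ≡ ∣ p ∣
length-filter-∈ {n} p = trans (length-filter≡sum (_∈? p) (allFin n)) (sym (∣p∣≡sum p))

2k≤k+m⇒2km≤b[k+m]⇒k≤b : ∀ {k m} b → 0 < k → 2 * k ≤ k + m → 2 * (k * m) ≤ b * (k + m) → k ≤ b
2k≤k+m⇒2km≤b[k+m]⇒k≤b {k@(suc _)} {m} b _ 2k≤k+m 2km≤b[k+m] = *-cancelʳ-≤ k b (k + m) (begin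
  k * (k + m)     ≡⟨ *-distribˡ-+ k k m ⟩
  k * k + k * m   ≤⟨ +-monoˡ-≤ (k * m) (*-monoʳ-≤ k k≤m) ⟩
  k * m + k * m   ≡⟨ cong (k * m +_) (+-identityʳ (k * m)) ⟨
  2 * (k * m)     ≤⟨ 2km≤b[k+m] ⟩
  b * (k + m)     ∎)
  where
  open ≤-Reasoning
  k≤m : k ≤ m
  k≤m = +-cancelˡ-≤ k k m (subst (_≤ k + m) (cong (k +_) (+-identityʳ k)) 2k≤k+m)

lookup-ext : ∀ {A : Set} {d} {v w : Vec A d} → (∀ i → lookup v i ≡ lookup w i) → v ≡ w
lookup-ext {v = v} {w} v≗w = begin
  v                   ≡⟨ tabulate∘lookup v ⟨
  tabulate (lookup v) ≡⟨ tabulate-cong v≗w ⟩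
  tabulate (lookup w) ≡⟨ tabulate∘lookup w ⟩
  w                   ∎
  where open ≡-Reasoning

∈-tabulate⇔ : ∀ {n} (f : Fin n → Bool) v → v ∈ tabulate f ⇔ f v ≡ true
∈-tabulate⇔ f v = mk⇔
  (λ v∈ → trans (sym (lookup∘tabulate f v)) ([]=⇒lookup v∈))
  (λ fv → lookup⇒[]= v (tabulate f) (trans (lookup∘tabulate f v) fv))

_≟ᵛ_ : ∀ {d} → DecidableEquality (CubeVert d)
_≟ᵛ_ = ≡-dec _≟ᵇ_

compl : ∀ {d} → CubeVert d → CubeVert d
compl = mapᵛ not

compl-involutive : ∀ {d} (v : CubeVert d) → compl (compl v) ≡ v
compl-involutive v = trans (sym (mapᵛ-∘ not not v)) (trans (map-cong not-involutive v) (map-id v))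

compl-injective : ∀ {d} {v w : CubeVert d} → compl v ≡ compl w → v ≡ w
compl-injective {v = v} {w} e = trans (sym (compl-involutive v)) (trans (cong compl e) (compl-involutive w))

disagree⇒compl : ∀ {d} {v w : CubeVert d} → (∀ i → lookup v i ≢ lookup w i) → compl v ≡ w
disagree⇒compl {v = v} h = lookup-ext λ i → trans (lookup-map i not v) (sym (¬-not (h i ∘ sym)))

flipAt : ∀ {d} → CubeVert d → Fin d → CubeVert d
flipAt v i = updateAt v i not

flipAt-≢ : ∀ {d} (v : CubeVert d) i → flipAt v i ≢ v
flipAt-≢ v i e = not-¬ refl (sym (trans (sym (lookup∘updateAt i v)) (cong (λ u → lookup u i) e)))

flipAt-injectiveʳ : ∀ {d} (v : CubeVert d) {i j} → flipAt v i ≡ flipAt v j → i ≡ j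
flipAt-injectiveʳ v {i} {j} e with i ≟ j
... | yes i≡j = i≡j
... | no i≢j = contradiction
  (trans (sym (lookup∘updateAt i v)) (trans (cong (λ u → lookup u i) e) (lookup∘updateAt′ i j i≢j v)))
  (not-¬ refl ∘ sym)

flipFirst : ∀ {d} → CubeVert d → Fin (suc d) → CubeVert d
flipFirst v zero = v
flipFirst (b ∷ v) (suc k) = not b ∷ flipFirst v k

-- Step i of the walk k ↦ flipFirst v k goes from k = inject₁ i to k = suc i; the bit picks one end.
endpoint : ∀ {d} → Bool → Fin d → Fin (suc d)
endpoint b i = if b then inject₁ i else suc i

flipFirst-fromℕ : ∀ {d} (v : CubeVert d) → flipFirst v (fromℕ d) ≡ compl v
flipFirst-fromℕ [] = refl
flipFirst-fromℕ (b ∷ v) = cong (not b ∷_) (flipFirst-fromℕ v)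

flipFirst-suc : ∀ {d} (v : CubeVert d) (i : Fin d) → flipFirst v (suc i) ≡ flipAt (flipFirst v (inject₁ i)) i
flipFirst-suc (b ∷ v) zero = refl
flipFirst-suc (b ∷ v) (suc i) = cong (not b ∷_) (flipFirst-suc v i)

flipFirst-involutive : ∀ {d} (v : CubeVert d) k → flipFirst (flipFirst v k) k ≡ v
flipFirst-involutive v zero = refl
flipFirst-involutive (b ∷ v) (suc k) = cong₂ _∷_ (not-involutive b) (flipFirst-involutive v k)

flipFirst-injective : ∀ {d} {v w : CubeVert d} k → flipFirst v k ≡ flipFirst w k → v ≡ w
flipFirst-injective {v = v} {w} k e =
  trans (sym (flipFirst-involutive v k)) (trans (cong (λ u → flipFirst u k) e) (flipFirst-involutive w k))

flipFirst-step-injective : ∀ {d} {v w : CubeVert d} {i j} →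
  flipFirst v (inject₁ i) ≡ flipFirst w (inject₁ j) → flipFirst v (suc i) ≡ flipFirst w (suc j) → v ≡ w
flipFirst-step-injective {v = v} {w} {i} {j} e₁ e₂
  with flipAt-injectiveʳ (flipFirst v (inject₁ i))
         (trans (sym (flipFirst-suc v i)) (trans e₂ (trans (flipFirst-suc w j) (cong (λ u → flipAt u j) (sym e₁)))))
... | refl = flipFirst-injective (inject₁ i) e₁

flipFirst-suc-≢ : ∀ {d} (v : CubeVert d) i → flipFirst v (suc i) ≢ flipFirst v (inject₁ i)
flipFirst-suc-≢ v i e = flipAt-≢ (flipFirst v (inject₁ i)) i (trans (sym (flipFirst-suc v i)) e)

isFace-dec : ∀ {d} {P : CubeVert d → Set} (P? : Decidable P) (I : Fin d → Bool) (a : CubeVert d) →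
  (∀ z → P z ⇔ (∀ i → I i ≡ true → lookup z i ≡ lookup a i)) → IsFace d (λ z → does (P? z))
isFace-dec P? I a P⇔ = I , a , λ z → mk⇔ (to (P⇔ z) ∘ does-true⇒ (P? z)) (dec-true (P? z) ∘ from (P⇔ z))

face-∋-antipodes⇒full : ∀ {d} {s : CubeVert d → Bool} → IsFace d s →
  ∀ a → s a ≡ true → s (compl a) ≡ true → ∀ z → s z ≡ true
face-∋-antipodes⇒full (I , b , H) a sa sa′ z = from (H z) λ i Ii →
  contradiction (trans (to (H a) sa i Ii) (sym (to (H (compl a)) sa′ i Ii)))
    (λ e → not-¬ refl (trans e (lookup-map i not a)))

facet-isFace : ∀ {d} (a : CubeVert d) i → IsFace d (λ z → does (lookup z i ≟ᵇ lookup a i))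
facet-isFace a i = isFace-dec (λ z → lookup z i ≟ᵇ lookup a i) (λ j → does (j ≟ i)) a λ z →
  mk⇔ (λ zᵢ≡aᵢ j Ij → fixes z zᵢ≡aᵢ j (does-true⇒ (j ≟ i) Ij)) (λ h → h i (dec-true (i ≟ i) refl))
  where
  fixes : ∀ z → lookup z i ≡ lookup a i → ∀ j → j ≡ i → lookup z j ≡ lookup a j
  fixes z zᵢ≡aᵢ j refl = zᵢ≡aᵢ

edge-isFace : ∀ {d} (v : CubeVert d) i → IsFace d (λ z → does (z ≟ᵛ v ⊎-dec z ≟ᵛ flipAt v i))
edge-isFace v i = isFace-dec (λ z → z ≟ᵛ v ⊎-dec z ≟ᵛ flipAt v i) (λ j → does (¬? (j ≟ i))) v λ z →
  mk⇔ (λ { (inj₁ refl) j _ → refl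
         ; (inj₂ refl) j Ij → lookup∘updateAt′ j i (does-true⇒ (¬? (j ≟ i)) Ij) v })
      (λ h → on-edge z (λ j j≢i → h j (dec-true (¬? (j ≟ i)) j≢i)))
  where
  on-edge : ∀ z → (∀ j → j ≢ i → lookup z j ≡ lookup v j) → z ≡ v ⊎ z ≡ flipAt v i
  on-edge z off with lookup z i ≟ᵇ lookup v i
  ... | yes zᵢ≡vᵢ = inj₁ (lookup-ext λ j → at j)
    where
    at : ∀ j → lookup z j ≡ lookup v j
    at j with j ≟ i
    ... | yes refl = zᵢ≡vᵢ
    ... | no j≢i = off j j≢i
  ... | no zᵢ≢vᵢ = inj₂ (lookup-ext λ j → at j)
    where
    at : ∀ j → lookup z j ≡ lookup (flipAt v i) j
    at j with j ≟ i
    ... | yes refl = trans (¬-not zᵢ≢vᵢ) (sym (lookup∘updateAt i v))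
    ... | no j≢i = trans (off j j≢i) (sym (lookup∘updateAt′ j i j≢i v))

pair-isImage : ∀ {n d} (f : CubeVert d → Fin n) v w →
  IsImage f (λ z → does (z ≟ᵛ v ⊎-dec z ≟ᵛ w)) (⁅ f v ⁆ ∪ ⁅ f w ⁆)
pair-isImage f v w u = mk⇔ into onto
  where
  into : u ∈ ⁅ f v ⁆ ∪ ⁅ f w ⁆ → Σ (CubeVert _) λ z → does (z ≟ᵛ v ⊎-dec z ≟ᵛ w) ≡ true × f z ≡ u
  into u∈ with x∈p∪q⁻ ⁅ f v ⁆ ⁅ f w ⁆ u∈
  ... | inj₁ u∈⁅fv⁆ = v , dec-true (v ≟ᵛ v ⊎-dec v ≟ᵛ w) (inj₁ refl) , sym (x∈⁅y⁆⇒x≡y (f v) u∈⁅fv⁆)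
  ... | inj₂ u∈⁅fw⁆ = w , dec-true (w ≟ᵛ v ⊎-dec w ≟ᵛ w) (inj₂ refl) , sym (x∈⁅y⁆⇒x≡y (f w) u∈⁅fw⁆)
  onto : (Σ (CubeVert _) λ z → does (z ≟ᵛ v ⊎-dec z ≟ᵛ w) ≡ true × f z ≡ u) → u ∈ ⁅ f v ⁆ ∪ ⁅ f w ⁆
  onto (z , sz , refl) with does-true⇒ (z ≟ᵛ v ⊎-dec z ≟ᵛ w) sz
  ... | inj₁ refl = x∈p∪q⁺ (inj₁ (x∈⁅x⁆ (f v)))
  ... | inj₂ refl = x∈p∪q⁺ (inj₂ (x∈⁅x⁆ (f w)))

module CubicalComplex {n : ℕ} {𝒞 : Family n} (cc : IsCubicalComplex n 𝒞) where

  Cube : Set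
  Cube = Σ (Subset n) (_∈𝒞 𝒞)

  vertices : Cube → Subset n
  vertices = proj₁

  cube-≡ : ∀ {κ κ′ : Cube} → vertices κ ≡ vertices κ′ → κ ≡ κ′
  cube-≡ {c , p} {.c , p′} refl = cong (c ,_) (Decidable⇒UIP.≡-irrelevant _≟ᵇ_ p p′)

  dim : Cube → ℕ
  dim (c , p) = proj₁ (proj₂ cc c p)

  φ : (κ : Cube) → CubeVert (dim κ) → Fin n
  φ (c , p) = proj₁ (proj₂ (proj₂ cc c p))

  φ-injective : (κ : Cube) → Injective _≡_ _≡_ (φ κ)
  φ-injective (c , p) = proj₁ (proj₁ (proj₂ (proj₂ (proj₂ cc c p))))

  φ-onto : (κ : Cube) (v : Fin n) → v ∈ vertices κ ⇔ ∃ λ z → φ κ z ≡ v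
  φ-onto (c , p) = proj₂ (proj₁ (proj₂ (proj₂ (proj₂ cc c p))))

  image∈𝒞⇔isFace : (κ : Cube) (s : CubeVert (dim κ) → Bool) (S : Subset n) →
    IsImage (φ κ) s S → S ∈𝒞 𝒞 ⇔ IsFace (dim κ) s
  image∈𝒞⇔isFace (c , p) = proj₂ (proj₂ (proj₂ (proj₂ cc c p)))

  φ∈ : (κ : Cube) (z : CubeVert (dim κ)) → φ κ z ∈ vertices κ
  φ∈ κ z = from (φ-onto κ (φ κ z)) (z , refl)

  preimage : (κ : Cube) → Fin n → CubeVert (dim κ)
  preimage κ v with v ∈? vertices κ
  ... | yes v∈κ = proj₁ (to (φ-onto κ v) v∈κ)
  ... | no _ = replicate _ false

  φ-preimage : (κ : Cube) {v : Fin n} → v ∈ vertices κ → φ κ (preimage κ v) ≡ v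
  φ-preimage κ {v} v∈κ with v ∈? vertices κ
  ... | yes v∈κ′ = proj₂ (to (φ-onto κ v) v∈κ′)
  ... | no v∉κ = contradiction v∈κ v∉κ

  preimage-φ : (κ : Cube) (z : CubeVert (dim κ)) → preimage κ (φ κ z) ≡ z
  preimage-φ κ z = φ-injective κ (φ-preimage κ (φ∈ κ z))

  image : (κ : Cube) → (CubeVert (dim κ) → Bool) → Subset n
  image κ s = tabulate λ v → does (v ∈? vertices κ ×-dec s (preimage κ v) ≟ᵇ true)

  ∈-image⇔ : (κ : Cube) (s : CubeVert (dim κ) → Bool) (v : Fin n) →
    v ∈ image κ s ⇔ (v ∈ vertices κ × s (preimage κ v) ≡ true)
  ∈-image⇔ κ s v = mk⇔
    (does-true⇒ (v ∈? vertices κ ×-dec _ ≟ᵇ true) ∘ to (∈-tabulate⇔ _ v))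
    (from (∈-tabulate⇔ _ v) ∘ dec-true (v ∈? vertices κ ×-dec _ ≟ᵇ true))

  image-isImage : (κ : Cube) (s : CubeVert (dim κ) → Bool) → IsImage (φ κ) s (image κ s)
  image-isImage κ s v = mk⇔
    (λ v∈ → let v∈κ , sv = to (∈-image⇔ κ s v) v∈ in preimage κ v , sv , φ-preimage κ v∈κ)
    (λ { (z , sz , refl) → from (∈-image⇔ κ s (φ κ z)) (φ∈ κ z , subst (λ u → s u ≡ true) (sym (preimage-φ κ z)) sz) })

  image⊆vertices : (κ : Cube) (s : CubeVert (dim κ) → Bool) → image κ s ⊆ vertices κ
  image⊆vertices κ s = proj₁ ∘ to (∈-image⇔ κ s _)

  antipodes∈⇒⊆ : (κ κ′ : Cube) (a : CubeVert (dim κ)) →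
    φ κ a ∈ vertices κ′ → φ κ (compl a) ∈ vertices κ′ → vertices κ ⊆ vertices κ′
  antipodes∈⇒⊆ κ κ′ a a∈κ′ a′∈κ′ v∈κ with to (φ-onto κ _) v∈κ
  ... | z , refl = does-true⇒ (φ κ z ∈? vertices κ′)
    (face-∋-antipodes⇒full face a (dec-true (_ ∈? vertices κ′) a∈κ′) (dec-true (_ ∈? vertices κ′) a′∈κ′) z)
    where
    s : CubeVert (dim κ) → Bool
    s y = does (φ κ y ∈? vertices κ′)
    meet-isImage : IsImage (φ κ) s (vertices κ ∩ vertices κ′)
    meet-isImage u = mk⇔
      (λ u∈ → let u∈κ , u∈κ′ = x∈p∩q⁻ _ _ u∈ ; y , φy≡u = to (φ-onto κ u) u∈κ in
              y , dec-true (φ κ y ∈? vertices κ′) (subst (_∈ vertices κ′) (sym φy≡u) u∈κ′) , φy≡u)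
      (λ { (y , sy , refl) → x∈p∩q⁺ (φ∈ κ y , does-true⇒ (φ κ y ∈? vertices κ′) sy) })
    face : IsFace (dim κ) s
    face = to (image∈𝒞⇔isFace κ s _ meet-isImage)
      (proj₁ cc _ _ (proj₂ κ) (proj₂ κ′) (φ κ a , x∈p∩q⁺ (φ∈ κ a , a∈κ′)))

  step-edge : (κ : Cube) (a : CubeVert (dim κ)) (i : Fin (dim κ)) →
    (⁅ φ κ (flipFirst a (inject₁ i)) ⁆ ∪ ⁅ φ κ (flipFirst a (suc i)) ⁆) ∈𝒞 𝒞
  step-edge κ a i = subst (λ w → (⁅ φ κ v ⁆ ∪ ⁅ φ κ w ⁆) ∈𝒞 𝒞) (sym (flipFirst-suc a i))
    (from (image∈𝒞⇔isFace κ _ _ (pair-isImage (φ κ) v (flipAt v i))) (edge-isFace v i))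
    where
    v : CubeVert (dim κ)
    v = flipFirst a (inject₁ i)

  Walk : Set
  Walk = Σ Cube λ κ → CubeVert (dim κ)

  trace : (κ : Cube) → CubeVert (dim κ) → Fin (dim κ) → Bool → (Fin n × Fin n) × Fin n
  trace κ a i b = (φ κ (flipFirst a (inject₁ i)) , φ κ (flipFirst a (suc i))) ,
                  φ κ (compl (flipFirst a (endpoint b i)))

  trace⇒⊆ : ∀ κ κ′ a a′ i i′ b b′ → trace κ a i b ≡ trace κ′ a′ i′ b′ → vertices κ ⊆ vertices κ′
  trace⇒⊆ κ κ′ a a′ i i′ b b′ e =
    antipodes∈⇒⊆ κ κ′ (flipFirst a (endpoint b i))
      (pivot∈ b (∈κ′ (cong (proj₁ ∘ proj₁) e)) (∈κ′ (cong (proj₂ ∘ proj₁) e))) (∈κ′ (cong proj₂ e))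
    where
    ∈κ′ : ∀ {u z} → u ≡ φ κ′ z → u ∈ vertices κ′
    ∈κ′ refl = φ∈ κ′ _
    pivot∈ : ∀ b → φ κ (flipFirst a (inject₁ i)) ∈ vertices κ′ → φ κ (flipFirst a (suc i)) ∈ vertices κ′ →
      φ κ (flipFirst a (endpoint b i)) ∈ vertices κ′
    pivot∈ true before∈ _ = before∈
    pivot∈ false _ after∈ = after∈

  trace-injective-within : ∀ κ {a a′ i i′} (b b′ : Bool) → trace κ a i b ≡ trace κ a′ i′ b′ → a ≡ a′ × b ≡ b′
  trace-injective-within κ {a} {a′} {i} {i′} b b′ e = by-pivot b b′ pivot≡
    where
    before≡ : flipFirst a (inject₁ i) ≡ flipFirst a′ (inject₁ i′)
    before≡ = φ-injective κ (cong (proj₁ ∘ proj₁) e)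
    after≡ : flipFirst a (suc i) ≡ flipFirst a′ (suc i′)
    after≡ = φ-injective κ (cong (proj₂ ∘ proj₁) e)
    pivot≡ : flipFirst a (endpoint b i) ≡ flipFirst a′ (endpoint b′ i′)
    pivot≡ = compl-injective (φ-injective κ (cong proj₂ e))
    by-pivot : ∀ b b′ → flipFirst a (endpoint b i) ≡ flipFirst a′ (endpoint b′ i′) →
      a ≡ a′ × b ≡ b′
    by-pivot true true _ = flipFirst-step-injective before≡ after≡ , refl
    by-pivot false false _ = flipFirst-step-injective before≡ after≡ , refl
    by-pivot true false e′ = contradiction (sym (trans e′ (sym after≡))) (flipFirst-suc-≢ a i)
    by-pivot false true e′ = contradiction (trans e′ (sym before≡)) (flipFirst-suc-≢ a i)

  trace-injective : ∀ κ κ′ a a′ i i′ b b′ → trace κ a i b ≡ trace κ′ a′ i′ b′ →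
    _≡_ {A = Walk} (κ , a) (κ′ , a′) × b ≡ b′
  trace-injective κ κ′ a a′ i i′ b b′ e
    with cube-≡ {κ} {κ′} (⊆-antisym (trace⇒⊆ κ κ′ a a′ i i′ b b′ e) (trace⇒⊆ κ′ κ a′ a i′ i b′ b (sym e)))
  ... | refl = let a≡a′ , b≡b′ = trace-injective-within κ b b′ e in cong (κ ,_) a≡a′ , b≡b′

  Antipodal : Cube → Fin n → Fin n → Set
  Antipodal κ x y = ∃ λ a → φ κ a ≡ x × φ κ (compl a) ≡ y

  antipodal-in-subcube : (κ : Cube) → Acc _<_ ∣ vertices κ ∣ →
    ∀ {x y} → x ∈ vertices κ → y ∈ vertices κ → Σ Cube λ κ′ → Antipodal κ′ x y
  antipodal-in-subcube κ (acc smaller) {x} {y} x∈κ y∈κ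
    with any? (λ i → lookup (preimage κ x) i ≟ᵇ lookup (preimage κ y) i)
  ... | no disagree = κ , preimage κ x , φ-preimage κ x∈κ ,
    trans (cong (φ κ) (disagree⇒compl λ i e → disagree (i , e))) (φ-preimage κ y∈κ)
  ... | yes (i , agree) = antipodal-in-subcube facet (smaller (p⊂q⇒∣p∣<∣q∣ facet⊂κ)) x∈facet y∈facet
    where
    a : CubeVert (dim κ)
    a = preimage κ x
    s : CubeVert (dim κ) → Bool
    s z = does (lookup z i ≟ᵇ lookup a i)
    facet : Cube
    facet = image κ s , from (image∈𝒞⇔isFace κ s _ (image-isImage κ s)) (facet-isFace a i)
    flip∉facet : φ κ (flipAt a i) ∉ image κ s
    flip∉facet m = not-¬ refl (sym (trans (sym (lookup∘updateAt i a))
      (does-true⇒ (_ ≟ᵇ _) (subst (λ u → s u ≡ true) (preimage-φ κ (flipAt a i)) (proj₂ (to (∈-image⇔ κ s _) m))))))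
    facet⊂κ : image κ s ⊂ vertices κ
    facet⊂κ = image⊆vertices κ s , φ κ (flipAt a i) , φ∈ κ _ , flip∉facet
    x∈facet : x ∈ image κ s
    x∈facet = from (∈-image⇔ κ s x) (x∈κ , dec-true (lookup a i ≟ᵇ lookup a i) refl)
    y∈facet : y ∈ image κ s
    y∈facet = from (∈-image⇔ κ s y) (y∈κ , dec-true (_ ≟ᵇ lookup a i) (sym agree))

  neighbourly⇒antipodal : IsNeighbourly n 𝒞 → ∀ x y → Σ Cube λ κ → Antipodal κ x y
  neighbourly⇒antipodal nb x y =
    let c , c∈𝒞 , x∈c , y∈c = nb x y in antipodal-in-subcube (c , c∈𝒞) (<-wellFounded _) x∈c y∈c

module DoubleCounting {n : ℕ} {𝒞 : Family n}
  (cc : IsCubicalComplex n 𝒞) (nb : IsNeighbourly n 𝒞) (X : Subset n) where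

  open CubicalComplex cc

  record CrossingStep (x y : Fin n) : Set where
    field
      cube : Cube
      start : CubeVert (dim cube)
      index : Fin (dim cube)
      start↦x : φ cube start ≡ x
      end↦y : φ cube (compl start) ≡ y
      before∈X : φ cube (flipFirst start (inject₁ index)) ∈ X
      after∉X : φ cube (flipFirst start (suc index)) ∉ X

    traceOf : Bool → (Fin n × Fin n) × Fin n
    traceOf = trace cube start index

  open CrossingStep

  crossingStep : ∀ {x y} → x ∈ X → y ∉ X → CrossingStep x y
  crossingStep {x} {y} x∈X y∉X with neighbourly⇒antipodal nb x y
  ... | κ , a , refl , refl with switches-off (λ k → φ κ (flipFirst a k) ∈? X) x∈X
                                   (y∉X ∘ subst (_∈ X) (cong (φ κ) (flipFirst-fromℕ a)))
  ... | i , before∈X , after∉X = record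
    { cube = κ ; start = a ; index = i ; start↦x = refl ; end↦y = refl
    ; before∈X = before∈X ; after∉X = after∉X }

  -- The value off the crossing pairs is irrelevant: only members of sources (below) are routed.
  route : Bool × (Fin n × Fin n) → (Fin n × Fin n) × Fin n
  route (b , x , y) with x ∈? X | y ∈? X
  ... | yes x∈X | no y∉X = traceOf (crossingStep x∈X y∉X) b
  ... | _ | _ = (x , x) , x

  route-crossing : ∀ b {x y} → x ∈ X → y ∉ X → Σ (CrossingStep x y) λ W → route (b , x , y) ≡ traceOf W b
  route-crossing b {x} {y} x∈X y∉X with x ∈? X | y ∈? X
  ... | yes x∈X′ | no y∉X′ = crossingStep x∈X′ y∉X′ , refl
  ... | no x∉X | _ = contradiction x∈X x∉X
  ... | yes _ | yes y∈X = contradiction y∈X y∉X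

  -- Exactly the summand of boundarySize 𝒞 X.
  isCut : Fin n × Fin n → Bool
  isCut (u , w) = does (u ∈? X) ∧ not (does (w ∈? X)) ∧ isEdge 𝒞 u w

  crossing-edge⇒isCut : ∀ {u w} → u ∈ X → w ∉ X → (⁅ u ⁆ ∪ ⁅ w ⁆) ∈𝒞 𝒞 → isCut (u , w) ≡ true
  crossing-edge⇒isCut {u} {w} u∈X w∉X edge
    rewrite dec-true (u ∈? X) u∈X | dec-false (w ∈? X) w∉X
          | dec-false (u ≟ w) (λ u≡w → w∉X (subst (_∈ X) u≡w u∈X)) = edge

  bools : List Bool
  bools = true ∷ false ∷ []

  inX outX : List (Fin n)
  inX = filter (_∈? X) (allFin n)
  outX = filter (_∈? ∁ X) (allFin n)

  cuts : List (Fin n × Fin n)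
  cuts = filter (T? ∘ isCut) (cartesianProduct (allFin n) (allFin n))

  sources : List (Bool × (Fin n × Fin n))
  sources = cartesianProduct bools (cartesianProduct inX outX)

  targets : List ((Fin n × Fin n) × Fin n)
  targets = cartesianProduct cuts (allFin n)

  sources-unique : Unique sources
  sources-unique = cartesianProduct⁺ (((λ ()) ∷ []) ∷ [] ∷ [])
    (cartesianProduct⁺ (filter⁺ (_∈? X) (allFin⁺ n)) (filter⁺ (_∈? ∁ X) (allFin⁺ n)))

  ∈sources⇒crossing : ∀ {b x y} → (b , x , y) ∈ˡ sources → x ∈ X × y ∉ X
  ∈sources⇒crossing m =
    let _ , xy∈ = ∈-cartesianProduct⁻ bools (cartesianProduct inX outX) m
        x∈ , y∈ = ∈-cartesianProduct⁻ inX outX xy∈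
    in proj₂ (∈-filter⁻ (_∈? X) {xs = allFin n} x∈) ,
       x∈∁p⇒x∉p (proj₂ (∈-filter⁻ (_∈? ∁ X) {xs = allFin n} y∈))

  trace∈targets : ∀ {x y} (W : CrossingStep x y) b → traceOf W b ∈ˡ targets
  trace∈targets W b = ∈-cartesianProduct⁺
    (∈-filter⁺ (T? ∘ isCut) (∈-cartesianProduct⁺ (∈-allFin _) (∈-allFin _))
      (from T-≡ (crossing-edge⇒isCut (before∈X W) (after∉X W) (step-edge (cube W) (start W) (index W)))))
    (∈-allFin _)

  route-on-sources : ∀ {b x y} → (b , x , y) ∈ˡ sources →
    Σ (CrossingStep x y) λ W → route (b , x , y) ≡ traceOf W b
  route-on-sources {b} m = let x∈X , y∉X = ∈sources⇒crossing m in route-crossing b x∈X y∉X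

  route-injective : ∀ {s s′} → s ∈ˡ sources → s′ ∈ˡ sources → route s ≡ route s′ → s ≡ s′
  route-injective {b , x , y} {b′ , x′ , y′} m m′ e with route-on-sources m | route-on-sources m′
  ... | W , r | W′ , r′
    with trace-injective (cube W) (cube W′) (start W) (start W′) (index W) (index W′) b b′
           (trans (sym r) (trans e r′))
  ... | walk≡ , refl = cong (b ,_) (cong₂ _,_
    (trans (sym (start↦x W)) (trans (cong (λ { (κ , a) → φ κ a }) walk≡) (start↦x W′)))
    (trans (sym (end↦y W)) (trans (cong (λ { (κ , a) → φ κ (compl a) }) walk≡) (end↦y W′))))

  route∈targets : ∀ {s} → s ∈ˡ sources → route s ∈ˡ targets
  route∈targets {b , x , y} m with route-on-sources m
  ... | W , r = subst (_∈ˡ targets) (sym r) (trace∈targets W b)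

  length-sources : length sources ≡ 2 * (∣ X ∣ * ∣ ∁ X ∣)
  length-sources = trans (length-cartesianProduct bools (cartesianProduct inX outX))
    (cong (2 *_) (trans (length-cartesianProduct inX outX)
      (cong₂ _*_ (length-filter-∈ X) (length-filter-∈ (∁ X)))))

  length-cuts : length cuts ≡ boundarySize 𝒞 X
  length-cuts = trans (length-filter≡sum (T? ∘ isCut) (cartesianProduct (allFin n) (allFin n)))
    (sum-cartesianProduct (λ e → if isCut e then 1 else 0) (allFin n) (allFin n))

  length-targets : length targets ≡ boundarySize 𝒞 X * n
  length-targets = trans (length-cartesianProduct cuts (allFin n))
    (cong₂ _*_ length-cuts (length-tabulate (λ i → i)))

  double-count : 2 * (∣ X ∣ * ∣ ∁ X ∣) ≤ boundarySize 𝒞 X * n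
  double-count = subst₂ _≤_ length-sources length-targets
    (length-≤-injection route sources-unique route-injective route∈targets)

theorem1 : (n : ℕ) (𝒞 : Family n) →
    IsCubicalComplex n 𝒞 → IsNeighbourly n 𝒞 → EdgeExpansionAtLeast 𝒞 1
theorem1 n 𝒞 cc nb X 0<∣X∣ 2∣X∣≤n =
  subst (_≤ boundarySize 𝒞 X) (sym (*-identityˡ ∣ X ∣))
    (2k≤k+m⇒2km≤b[k+m]⇒k≤b (boundarySize 𝒞 X) 0<∣X∣
      (subst (2 * ∣ X ∣ ≤_) (sym ∣X∣+∣∁X∣≡n) 2∣X∣≤n)
      (subst (λ m → 2 * (∣ X ∣ * ∣ ∁ X ∣) ≤ boundarySize 𝒞 X * m) (sym ∣X∣+∣∁X∣≡n) double-count))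
  where
  open DoubleCounting cc nb X using (double-count)
  ∣X∣+∣∁X∣≡n : ∣ X ∣ + ∣ ∁ X ∣ ≡ n
  ∣X∣+∣∁X∣≡n = trans (cong (∣ X ∣ +_) (∣∁p∣≡n∸∣p∣ X)) (m+[n∸m]≡n (∣p∣≤n X))
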